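{- Let $n\ge 2$ and $m\ge 1$ be integers, and let ${\bm M}_{n,m}=\mathrm{circ}(mn,-m,\ldots,-m)\in\mathbb{Z}^{n\times n}$ be the circulant matrix whose diagonal entries are all $mn$ and whose off-diagonal entries are all $-m$. Let $G_{{\bm M}_{n,m}}=\mathrm{Cay}(\mathbb{Z}^n/{\bm M}_{n,m}\mathbb{Z}^n,\{\mathbf e_1,\ldots,\mathbf e_n\})$, where $\mathbf e_1,\ldots,\mathbf e_n$ are the images of the standard unit coordinate vectors. Then $G_{{\bm M}_{n,m}}$ has order $N_{n,m}=m^n(n+1)^{n-1}$ and diameter $k_{n,m}=\binom{n+1}{2}m-n$.
   Context: For an Abelian group $\Gamma$ and a generating set $A\subseteq\Gamma$, the Cayley digraph $\mathrm{Cay}(\Gamma;A)$ has vertex set $\Gamma$ and an arc $(u,v)$ if and only if $v-u\in A$. Its order is $|\Gamma|$ and its diameter is the maximum, over ordered pairs of vertices $(u,v)$, of the length of a shortest directed path from $u$ to $v$. For a nonsingular integral $n\times n$ matrix ${\bm M}$, $\mathbb{Z}^n/{\bm M}\mathbb{Z}^n$ is the quotient of $\mathbb{Z}^n$ by the lattice generated by the columns of ${\bm M}$. -}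

module Defs where

open import Data.Nat using (ℕ; zero; suc; _≤_)
open import Data.Integer as ℤ using (ℤ; +_; -_; _-_; _*_)
open import Data.Fin using (Fin; zero; suc; _≟_)
open import Data.Product using (Σ; ∃; ∃-syntax; _×_; _,_)
open import Relation.Nullary using (¬_; does)
open import Relation.Binary.PropositionalEquality using (_≡_)
open import Data.Bool using (if_then_else_)

Vecℤ : ℕ → Set
Vecℤ n = Fin n → ℤ

sumℤ : ∀ {n} → Vecℤ n → ℤ
sumℤ {zero}  v = + 0
sumℤ {suc n} v = v zero ℤ.+ sumℤ (λ i → v (suc i))

Matℤ : ℕ → Set
Matℤ n = Fin n → Fin n → ℤ

_·_ : ∀ {n} → Matℤ n → Vecℤ n → Vecℤ n
(M · c) i = sumℤ (λ j → M i j * c j)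

Mcirc : (n m : ℕ) → Matℤ n
Mcirc n m i j = if does (i ≟ j) then + (m ℕ.* n) else - (+ m)
  where import Data.Nat as ℕ

e : ∀ {n} → Fin n → Vecℤ n
e i j = if does (i ≟ j) then + 1 else + 0

InLattice : ∀ {n} → Matℤ n → Vecℤ n → Set
InLattice M x = ∃[ c ] (∀ i → x i ≡ (M · c) i)

-- Congruence modulo M ℤ^n: equality in ℤ^n / M ℤ^n.
_≈[_]_ : ∀ {n} → Vecℤ n → Matℤ n → Vecℤ n → Set
u ≈[ M ] v = InLattice M (λ i → u i - v i)

-- The quotient ℤ^n / M ℤ^n has exactly N elements: there is a map
-- Fin N → ℤ^n that is surjective onto classes and injective on classes.
QuotientOrder : ∀ {n} → Matℤ n → ℕ → Set
QuotientOrder {n} M N =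
  Σ (Fin N → Vecℤ n) λ f →
    (∀ u → ∃[ i ] (u ≈[ M ] f i)) ×
    (∀ i j → f i ≈[ M ] f j → i ≡ j)

-- Arc (u,v) of Cay(ℤ^n / M ℤ^n; {e_1,...,e_n}) on representatives:
-- v - u equals some e_i in the quotient.
Arc : ∀ {n} → Matℤ n → Vecℤ n → Vecℤ n → Set
Arc {n} M u v = ∃[ i ] ((λ j → v j - u j) ≈[ M ] e i)

data Walk {n} (M : Matℤ n) : ℕ → Vecℤ n → Vecℤ n → Set where
  here : ∀ {u v} → u ≈[ M ] v → Walk M 0 u v
  step : ∀ {k u v w} → Arc M u v → Walk M k v w → Walk M (suc k) u w

-- The Cayley digraph has diameter D: every ordered pair is joined by a
-- directed walk of length ≤ D, and some pair has distance exactly ≥ D.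
Diameter : ∀ {n} → Matℤ n → ℕ → Set
Diameter {n} M D =
  (∀ u v → ∃[ k ] (k ≤ D × Walk M k u v)) ×
  (∃[ u ] ∃[ v ] (∀ k → Walk M k u v → D ≤ k))

module Submission where

-- The lattice M ℤⁿ for M = circ(mn, -m, …, -m) has the explicit form
--   M ℤⁿ = { m·(t + (n+1)·d) : t ∈ ℤ, d ∈ ℤⁿ },
-- i.e. x ∈ M ℤⁿ iff every x_i = m·y_i with all y_i congruent mod n+1.
-- So every class of ℤⁿ / M ℤⁿ has a unique "digit" representative
-- s_j + m·w_j with 0 ≤ s_j < m, 0 ≤ w_j ≤ n and w_1 = 0, giving the order
-- m^n (n+1)^(n-1).  In the Cayley digraph a walk of length k from u to v
-- is the same as a vector a ∈ ℕⁿ of step counts with Σa = k and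
-- v - u ≡ a (mod M ℤⁿ).  Upper bound: reduce v - u to digits s + m·w,
-- where the high digits w may be rotated by any common shift mod n+1;
-- a minimal rotation has Σw ≤ C(n,2) (counting, for each level, how many
-- digits wrap around).  Lower bound: a walk from 0 to the vertex with
-- digits (m-1, j) must use counts a_j = (m-1) + m·b_j with the b_j pairwise
-- distinct, so Σb ≥ C(n,2).

open import Defs
open import Data.Nat using (ℕ; _≤_; _*_; _^_; _∸_; suc)
open import Data.Nat.Combinatorics using (_C_)
open import Data.Product using (_×_)

open import Data.Nat using (zero; _+_; _<_; z≤n; s≤s; NonZero; _%_; _/_; _≤?_)
import Data.Nat.Properties as NP
import Data.Nat.DivMod as ND
import Data.Nat.Combinatorics as NC
import Data.Nat.Tactic.RingSolver as NS
open import Data.Integer using (ℤ; +_; -[1+_])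
  renaming (_+_ to _+ᶻ_; _*_ to _*ᶻ_; _-_ to _-ᶻ_; -_ to -ᶻ_)
import Data.Integer.Properties as ZP
import Data.Integer.DivMod as ZD
open import Data.Integer.Tactic.RingSolver using (solve-∀)
open import Data.Fin using (Fin; zero; suc; toℕ; fromℕ<; _≟_; punchIn)
import Data.Fin.Properties as FP
open import Data.Fin.Base using (remQuot; combine; finToFun; funToFin)
open import Data.Product using (Σ; ∃-syntax; _,_; proj₁; proj₂)
open import Data.Sum using (_⊎_; inj₁; inj₂; [_,_])
open import Data.Bool using (true; false; if_then_else_)
open import Data.Empty using (⊥-elim)
open import Function using (_∘_)
open import Relation.Nullary using (does; yes; no)
open import Relation.Nullary.Decidable using (dec-true; dec-false)
open import Relation.Binary.PropositionalEquality
  using (_≡_; refl; sym; trans; cong; cong₂; subst; subst₂; module ≡-Reasoning)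
open ≡-Reasoning
open import Algebra.Properties.Semiring.Sum NP.+-*-semiring
  using (sum; sum-cong-≗; ∑-distrib-+; *-distribˡ-sum; sum-remove; sum-replicate-zero)

sumℤ-cong : ∀ {n} {f g : Vecℤ n} → (∀ i → f i ≡ g i) → sumℤ f ≡ sumℤ g
sumℤ-cong {zero}  f≗g = refl
sumℤ-cong {suc n} f≗g = cong₂ _+ᶻ_ (f≗g zero) (sumℤ-cong (f≗g ∘ suc))

sumℤ-+ : ∀ {n} (f g : Vecℤ n) → sumℤ (λ i → f i +ᶻ g i) ≡ sumℤ f +ᶻ sumℤ g
sumℤ-+ {zero}  f g = refl
sumℤ-+ {suc n} f g = begin
  (f zero +ᶻ g zero) +ᶻ sumℤ (λ i → f (suc i) +ᶻ g (suc i))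
    ≡⟨ cong ((f zero +ᶻ g zero) +ᶻ_) (sumℤ-+ (f ∘ suc) (g ∘ suc)) ⟩
  (f zero +ᶻ g zero) +ᶻ (sumℤ (f ∘ suc) +ᶻ sumℤ (g ∘ suc))
    ≡⟨ interchange (f zero) (g zero) _ _ ⟩
  (f zero +ᶻ sumℤ (f ∘ suc)) +ᶻ (g zero +ᶻ sumℤ (g ∘ suc)) ∎
  where
  interchange : ∀ a b c d → (a +ᶻ b) +ᶻ (c +ᶻ d) ≡ (a +ᶻ c) +ᶻ (b +ᶻ d)
  interchange = solve-∀

sumℤ-scale : ∀ {n} (a : ℤ) (f : Vecℤ n) → sumℤ (λ i → a *ᶻ f i) ≡ a *ᶻ sumℤ f
sumℤ-scale {zero}  a f = sym (ZP.*-zeroʳ a)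
sumℤ-scale {suc n} a f =
  trans (cong (a *ᶻ f zero +ᶻ_) (sumℤ-scale a (f ∘ suc))) (sym (ZP.*-distribˡ-+ a (f zero) _))

sumℤ-const : ∀ {n} (a : ℤ) → sumℤ {n} (λ _ → a) ≡ + n *ᶻ a
sumℤ-const {zero}  a = sym (ZP.*-zeroˡ a)
sumℤ-const {suc n} a = trans (cong (a +ᶻ_) (sumℤ-const {n} a)) (sym (ZP.suc-* (+ n) a))

sumℤ-diag : ∀ {n} (i : Fin n) (A B : ℤ) (c : Vecℤ n) →
  sumℤ (λ j → (if does (i ≟ j) then A else B) *ᶻ c j) ≡ (A -ᶻ B) *ᶻ c i +ᶻ B *ᶻ sumℤ c
sumℤ-diag {suc n} zero A B c =
  trans (cong (A *ᶻ c zero +ᶻ_) (sumℤ-scale B (c ∘ suc))) (regroup A B (c zero) _)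
  where
  regroup : ∀ A B c₀ S → A *ᶻ c₀ +ᶻ B *ᶻ S ≡ (A -ᶻ B) *ᶻ c₀ +ᶻ B *ᶻ (c₀ +ᶻ S)
  regroup = solve-∀
sumℤ-diag {suc n} (suc i) A B c =
  trans (cong (B *ᶻ c zero +ᶻ_) (sumℤ-diag i A B (c ∘ suc))) (regroup A B (c zero) (c (suc i)) _)
  where
  regroup : ∀ A B c₀ cᵢ S → B *ᶻ c₀ +ᶻ ((A -ᶻ B) *ᶻ cᵢ +ᶻ B *ᶻ S) ≡ (A -ᶻ B) *ᶻ cᵢ +ᶻ B *ᶻ (c₀ +ᶻ S)
  regroup = solve-∀

sumℤ-units : ∀ {n} (a : Fin n → ℕ) j → sumℤ (λ l → + a l *ᶻ e l j) ≡ + a j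
sumℤ-units {suc n} a zero = begin
  + a zero *ᶻ + 1 +ᶻ sumℤ (λ l → + a (suc l) *ᶻ + 0)
    ≡⟨ cong₂ _+ᶻ_ (ZP.*-identityʳ (+ a zero)) (sumℤ-cong (λ l → ZP.*-zeroʳ (+ a (suc l)))) ⟩
  + a zero +ᶻ sumℤ {n} (λ _ → + 0)  ≡⟨ cong (+ a zero +ᶻ_) (trans (sumℤ-const {n} (+ 0)) (ZP.*-zeroʳ (+ n))) ⟩
  + a zero +ᶻ + 0                    ≡⟨ ZP.+-identityʳ (+ a zero) ⟩
  + a zero ∎
sumℤ-units {suc n} a (suc j) =
  trans (cong (_+ᶻ sumℤ (λ l → + a (suc l) *ᶻ e l j)) (ZP.*-zeroʳ (+ a zero)))
        (trans (ZP.+-identityˡ _) (sumℤ-units (a ∘ suc) j))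

sum-const : ∀ {n} (a : ℕ) → sum {n} (λ _ → a) ≡ n * a
sum-const {zero}  a = refl
sum-const {suc n} a = cong (λ s → a + s) (sum-const {n} a)

sum-mono : ∀ {n} {f g : Fin n → ℕ} → (∀ i → f i ≤ g i) → sum f ≤ sum g
sum-mono {zero}  f≤g = z≤n
sum-mono {suc n} f≤g = NP.+-mono-≤ (f≤g zero) (sum-mono (f≤g ∘ suc))

δ : ∀ {n} → Fin n → Fin n → ℕ
δ i j = if does (i ≟ j) then 1 else 0

sum-δ : ∀ {n} (i : Fin n) → sum (δ i) ≡ 1
sum-δ {suc n} zero    = cong suc (sum-replicate-zero n)
sum-δ {suc n} (suc i) = sum-δ i

δ≡e : ∀ {n} (i j : Fin n) → + δ i j ≡ e i j
δ≡e i j with does (i ≟ j)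
... | true  = refl
... | false = refl

infixl 6 _⊕_ _⊖_

_⊕_ : ∀ {n} → Vecℤ n → Vecℤ n → Vecℤ n
(x ⊕ y) i = x i +ᶻ y i

_⊖_ : ∀ {n} → Vecℤ n → Vecℤ n → Vecℤ n
(x ⊖ y) i = x i -ᶻ y i

⟦_⟧ : ∀ {n} → (Fin n → ℕ) → Vecℤ n
⟦ a ⟧ i = + a i

ConstModulo : ∀ {n} → ℕ → Vecℤ n → Set
ConstModulo {n} c x = Σ ℤ λ t → Σ (Vecℤ n) λ d → ∀ i → x i ≡ t +ᶻ + c *ᶻ d i

constModulo-diff : ∀ {n c} {x : Vecℤ n} → ConstModulo c x → ∀ i j → Σ ℤ λ z → x i -ᶻ x j ≡ + c *ᶻ z
constModulo-diff {c = c} {x} (t , d , x≡) i j = d i -ᶻ d j , (begin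
  x i -ᶻ x j                                  ≡⟨ cong₂ _-ᶻ_ (x≡ i) (x≡ j) ⟩
  (t +ᶻ + c *ᶻ d i) -ᶻ (t +ᶻ + c *ᶻ d j)      ≡⟨ factor t (+ c) (d i) (d j) ⟩
  + c *ᶻ (d i -ᶻ d j) ∎)
  where
  factor : ∀ t c dᵢ dⱼ → (t +ᶻ c *ᶻ dᵢ) -ᶻ (t +ᶻ c *ᶻ dⱼ) ≡ c *ᶻ (dᵢ -ᶻ dⱼ)
  factor = solve-∀

module Lattice (n m : ℕ) where

  M : Matℤ n
  M = Mcirc n m

  Lat : Vecℤ n → Set
  Lat x = Σ ℤ λ t → Σ (Vecℤ n) λ d → ∀ i → x i ≡ + m *ᶻ (t +ᶻ + suc n *ᶻ d i)

  M-row : ∀ c i → (M · c) i ≡ + m *ᶻ (+ suc n *ᶻ c i -ᶻ sumℤ c)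
  M-row c i = begin
    (M · c) i
      ≡⟨ sumℤ-diag i (+ (m * n)) (-ᶻ + m) c ⟩
    (+ (m * n) -ᶻ -ᶻ + m) *ᶻ c i +ᶻ (-ᶻ + m) *ᶻ sumℤ c
      ≡⟨ cong (λ z → (z -ᶻ -ᶻ + m) *ᶻ c i +ᶻ (-ᶻ + m) *ᶻ sumℤ c) (ZP.pos-* m n) ⟩
    (+ m *ᶻ + n -ᶻ -ᶻ + m) *ᶻ c i +ᶻ (-ᶻ + m) *ᶻ sumℤ c
      ≡⟨ factor (+ m) (+ n) (c i) (sumℤ c) ⟩
    + m *ᶻ (+ suc n *ᶻ c i -ᶻ sumℤ c) ∎
    where
    factor : ∀ m n cᵢ S → (m *ᶻ n -ᶻ -ᶻ m) *ᶻ cᵢ +ᶻ (-ᶻ m) *ᶻ S ≡ m *ᶻ ((+ 1 +ᶻ n) *ᶻ cᵢ -ᶻ S)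
    factor = solve-∀

  inLattice⇒Lat : ∀ {x} → InLattice M x → Lat x
  inLattice⇒Lat {x} (c , x≡Mc) = -ᶻ sumℤ c , c , λ i → begin
    x i                                    ≡⟨ x≡Mc i ⟩
    (M · c) i                              ≡⟨ M-row c i ⟩
    + m *ᶻ (+ suc n *ᶻ c i -ᶻ sumℤ c)       ≡⟨ reorder (+ m) (+ suc n) (c i) (sumℤ c) ⟩
    + m *ᶻ (-ᶻ sumℤ c +ᶻ + suc n *ᶻ c i) ∎
    where
    reorder : ∀ m s cᵢ S → m *ᶻ (s *ᶻ cᵢ -ᶻ S) ≡ m *ᶻ (-ᶻ S +ᶻ s *ᶻ cᵢ)
    reorder = solve-∀

  -- Conversely m·(t + (n+1)d) = M·c for c = d + (t + Σd).
  Lat⇒inLattice : ∀ {x} → Lat x → InLattice M x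
  Lat⇒inLattice {x} (t , d , x≡) = c , λ i → begin
    x i                                                   ≡⟨ x≡ i ⟩
    + m *ᶻ (t +ᶻ + suc n *ᶻ d i)                           ≡⟨ expand (+ m) (+ n) t (d i) (sumℤ d) ⟩
    + m *ᶻ (+ suc n *ᶻ c i -ᶻ (sumℤ d +ᶻ + n *ᶻ r))        ≡⟨ cong (λ S → + m *ᶻ (+ suc n *ᶻ c i -ᶻ S)) (sym Σc) ⟩
    + m *ᶻ (+ suc n *ᶻ c i -ᶻ sumℤ c)                      ≡⟨ sym (M-row c i) ⟩
    (M · c) i ∎
    where
    r : ℤ
    r = t +ᶻ sumℤ d
    c : Vecℤ n
    c i = d i +ᶻ r
    Σc : sumℤ c ≡ sumℤ d +ᶻ + n *ᶻ r
    Σc = trans (sumℤ-+ d (λ _ → r)) (cong (sumℤ d +ᶻ_) (sumℤ-const {n} r))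
    expand : ∀ m n t dᵢ S →
      m *ᶻ (t +ᶻ (+ 1 +ᶻ n) *ᶻ dᵢ) ≡ m *ᶻ ((+ 1 +ᶻ n) *ᶻ (dᵢ +ᶻ (t +ᶻ S)) -ᶻ (S +ᶻ n *ᶻ (t +ᶻ S)))
    expand = solve-∀

  Lat-≗ : ∀ {x y} → (∀ i → x i ≡ y i) → Lat x → Lat y
  Lat-≗ x≗y (t , d , x≡) = t , d , λ i → trans (sym (x≗y i)) (x≡ i)

  Lat-0 : ∀ {x} → (∀ i → x i ≡ + 0) → Lat x
  Lat-0 x≡0 = + 0 , (λ _ → + 0) , λ i → trans (x≡0 i) (sym (vanish (+ m) (+ suc n)))
    where
    vanish : ∀ m s → m *ᶻ (+ 0 +ᶻ s *ᶻ + 0) ≡ + 0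
    vanish = solve-∀

  Lat-neg : ∀ {x} → Lat x → Lat (λ i → -ᶻ x i)
  Lat-neg (t , d , x≡) = -ᶻ t , (λ i → -ᶻ d i) , λ i →
    trans (cong -ᶻ_ (x≡ i)) (negate (+ m) (+ suc n) t (d i))
    where
    negate : ∀ m s t dᵢ → -ᶻ (m *ᶻ (t +ᶻ s *ᶻ dᵢ)) ≡ m *ᶻ (-ᶻ t +ᶻ s *ᶻ (-ᶻ dᵢ))
    negate = solve-∀

  Lat-⊕ : ∀ {x y} → Lat x → Lat y → Lat (x ⊕ y)
  Lat-⊕ (t , d , x≡) (t' , d' , y≡) = t +ᶻ t' , (λ i → d i +ᶻ d' i) , λ i →
    trans (cong₂ _+ᶻ_ (x≡ i) (y≡ i)) (add (+ m) (+ suc n) t t' (d i) (d' i))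
    where
    add : ∀ m s t t' dᵢ dᵢ' →
      m *ᶻ (t +ᶻ s *ᶻ dᵢ) +ᶻ m *ᶻ (t' +ᶻ s *ᶻ dᵢ') ≡ m *ᶻ ((t +ᶻ t') +ᶻ s *ᶻ (dᵢ +ᶻ dᵢ'))
    add = solve-∀

  -- Congruence modulo M ℤⁿ, i.e. equality in ℤⁿ / M ℤⁿ.  (A record, so
  -- that the two vectors can be inferred from the type.)
  infix 4 _≅_
  record _≅_ (x y : Vecℤ n) : Set where
    constructor ≅-by
    field difference : Lat (x ⊖ y)
  open _≅_ public

  ≅⇒≈ : ∀ {x y} → x ≅ y → x ≈[ M ] y
  ≅⇒≈ x≅y = Lat⇒inLattice (difference x≅y)

  ≈⇒≅ : ∀ {x y} → x ≈[ M ] y → x ≅ y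
  ≈⇒≅ x≈y = ≅-by (inLattice⇒Lat x≈y)

  ≅-resp : ∀ {x x' y y'} → (∀ i → x i ≡ x' i) → (∀ i → y i ≡ y' i) → x' ≅ y' → x ≅ y
  ≅-resp x≗x' y≗y' (≅-by l) = ≅-by (Lat-≗ (λ i → sym (cong₂ _-ᶻ_ (x≗x' i) (y≗y' i))) l)

  ≅-refl : ∀ {x} → x ≅ x
  ≅-refl {x} = ≅-by (Lat-0 (λ i → ZP.+-inverseʳ (x i)))

  ≅-⊕ : ∀ {x x' y y'} → x ≅ y → x' ≅ y' → x ⊕ x' ≅ y ⊕ y'
  ≅-⊕ {x} {x'} {y} {y'} (≅-by p) (≅-by q) =
    ≅-by (Lat-≗ (λ i → interchange (x i) (x' i) (y i) (y' i)) (Lat-⊕ p q))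
    where
    interchange : ∀ a a' b b' → (a -ᶻ b) +ᶻ (a' -ᶻ b') ≡ (a +ᶻ a') -ᶻ (b +ᶻ b')
    interchange = solve-∀

  ≅-⊖ : ∀ {x x' y y'} → x ≅ y → x' ≅ y' → x ⊖ x' ≅ y ⊖ y'
  ≅-⊖ {x} {x'} {y} {y'} (≅-by p) (≅-by q) =
    ≅-by (Lat-≗ (λ i → interchange (x i) (x' i) (y i) (y' i)) (Lat-⊕ p (Lat-neg q)))
    where
    interchange : ∀ a a' b b' → (a -ᶻ b) +ᶻ -ᶻ (a' -ᶻ b') ≡ (a -ᶻ a') -ᶻ (b -ᶻ b')
    interchange = solve-∀

  ≅-sym : ∀ {x y} → x ≅ y → y ≅ x
  ≅-sym {x} {y} (≅-by p) = ≅-by (Lat-≗ (λ i → flip (x i) (y i)) (Lat-neg p))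
    where
    flip : ∀ a b → -ᶻ (a -ᶻ b) ≡ b -ᶻ a
    flip = solve-∀

  ≅-trans : ∀ {x y z} → x ≅ y → y ≅ z → x ≅ z
  ≅-trans {x} {y} {z} (≅-by p) (≅-by q) = ≅-by (Lat-≗ (λ i → telescope (x i) (y i) (z i)) (Lat-⊕ p q))
    where
    telescope : ∀ a b c → (a -ᶻ b) +ᶻ (b -ᶻ c) ≡ a -ᶻ c
    telescope = solve-∀

  difference≅0 : ∀ {x y z} → (∀ i → z i ≡ + 0) → (x ⊖ y) ≅ z → x ≅ y
  difference≅0 {x} {y} {z} z≡0 (≅-by p) = ≅-by (Lat-≗ drop-zero p)
    where
    drop-zero : ∀ i → (x i -ᶻ y i) -ᶻ z i ≡ x i -ᶻ y i
    drop-zero i = trans (cong (λ c → (x i -ᶻ y i) -ᶻ c) (z≡0 i)) (ZP.+-identityʳ _)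

  ≅-translation : ∀ {u x} → (u ⊕ x) ⊖ u ≅ x
  ≅-translation {u} {x} = ≅-by (Lat-0 (λ j → cancel (u j) (x j)))
    where
    cancel : ∀ a b → ((a +ᶻ b) -ᶻ a) -ᶻ b ≡ + 0
    cancel = solve-∀

  ≅-advance : ∀ {u w x d} → (w ⊖ u) ≅ d ⊕ x → (w ⊖ (u ⊕ d)) ≅ x
  ≅-advance {u} {w} {x} {d} w-u≅d+x =
    ≅-resp (λ j → regroup (w j) (u j) (d j)) (λ j → cancel (d j) (x j)) (≅-⊖ w-u≅d+x (≅-refl {d}))
    where
    regroup : ∀ a b c → a -ᶻ (b +ᶻ c) ≡ (a -ᶻ b) -ᶻ c
    regroup = solve-∀
    cancel : ∀ a b → b ≡ (a +ᶻ b) -ᶻ a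
    cancel = solve-∀

  walk-from : ∀ {k u u' w} → u ≅ u' → Walk M k u' w → Walk M k u w
  walk-from u≅u' (here u'≈w) = here (≅⇒≈ (≅-trans u≅u' (≈⇒≅ u'≈w)))
  walk-from u≅u' (step {v = v} (i , arc) W) =
    step (i , ≅⇒≈ (≅-trans (≅-⊖ (≅-refl {v}) u≅u') (≈⇒≅ arc))) W

  prepend : ∀ k i {l u v w} → (v ⊖ u) ≅ (λ j → + k *ᶻ e i j) → Walk M l v w → Walk M (k + l) u w
  prepend zero i {u = u} {v} v-u≅0 W =
    walk-from (≅-sym (difference≅0 {v} {u} (λ j → ZP.*-zeroˡ (e i j)) v-u≅0)) W
  prepend (suc k) i {u = u} {v} v-u≅ke W =
    step (i , ≅⇒≈ (≅-translation {u} {e i}))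
      (prepend k i (≅-advance {u} {v} {d = e i} (≅-resp (λ _ → refl) unfold v-u≅ke)) W)
    where
    unfold : ∀ j → e i j +ᶻ + k *ᶻ e i j ≡ + suc k *ᶻ e i j
    unfold j = sym (ZP.suc-* (+ k) (e i j))

  walkAlong : ∀ {k} (c : Fin k → ℕ) (g : Fin k → Fin n) {u w} →
    (w ⊖ u) ≅ (λ j → sumℤ (λ l → + c l *ᶻ e (g l) j)) → Walk M (sum c) u w
  walkAlong {zero}  c g {u} {w} w-u≅0 = here (≅⇒≈ (≅-sym (difference≅0 {w} {u} (λ _ → refl) w-u≅0)))
  walkAlong {suc k} c g {u} {w} w-u≅Σ = prepend (c zero) (g zero) (≅-translation {u} {first})
    (walkAlong (c ∘ suc) (g ∘ suc) (≅-advance {u} {w} {d = first} w-u≅Σ))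
    where
    first : Vecℤ n
    first j = + c zero *ᶻ e (g zero) j

  walkWithCounts : ∀ (a : Fin n → ℕ) {u w} → (w ⊖ u) ≅ ⟦ a ⟧ → Walk M (sum a) u w
  walkWithCounts a w-u≅a = walkAlong a (λ l → l) (≅-resp (λ _ → refl) (sumℤ-units a) w-u≅a)

  stepCounts : ∀ {k u w} → Walk M k u w → Σ (Fin n → ℕ) λ a → sum a ≡ k × (w ⊖ u) ≅ ⟦ a ⟧
  stepCounts {w = w} (here u≈w) = (λ _ → 0) , sum-replicate-zero n ,
    ≅-resp (λ _ → refl) (λ j → sym (ZP.+-inverseʳ (w j))) (≅-⊖ (≅-refl {w}) (≈⇒≅ u≈w))
  stepCounts {suc k} {u} {w} (step {v = v} (i , arc) W) with stepCounts W
  ... | a , Σa≡k , w-v≅a = (λ j → a j + δ i j) , Σ≡ , ≅-resp split merge (≅-⊕ w-v≅a (≈⇒≅ arc))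
    where
    telescope : ∀ a b c → a -ᶻ c ≡ (a -ᶻ b) +ᶻ (b -ᶻ c)
    telescope = solve-∀
    split : ∀ j → w j -ᶻ u j ≡ (w j -ᶻ v j) +ᶻ (v j -ᶻ u j)
    split j = telescope (w j) (v j) (u j)
    merge : ∀ j → + (a j + δ i j) ≡ + a j +ᶻ e i j
    merge j = trans (ZP.pos-+ (a j) (δ i j)) (cong (+ a j +ᶻ_) (δ≡e i j))
    Σ≡ : sum (λ j → a j + δ i j) ≡ suc k
    Σ≡ = trans (∑-distrib-+ a (δ i)) (trans (cong₂ _+_ Σa≡k (sum-δ i)) (NP.+-comm k 1))

pos-digits : ∀ m a b → + (a + m * b) ≡ + a +ᶻ + m *ᶻ + b
pos-digits m a b = trans (ZP.pos-+ a (m * b)) (cong (+ a +ᶻ_) (ZP.pos-* m b))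

pos-divMod : ∀ a d .{{_ : NonZero d}} → + a ≡ + (a % d) +ᶻ + (a / d) *ᶻ + d
pos-divMod a d = begin
  + a                          ≡⟨ cong +_ (ND.m≡m%n+[m/n]*n a d) ⟩
  + (a % d + (a / d) * d)      ≡⟨ ZP.pos-+ (a % d) ((a / d) * d) ⟩
  + (a % d) +ᶻ + ((a / d) * d) ≡⟨ cong (+ (a % d) +ᶻ_) (ZP.pos-* (a / d) d) ⟩
  + (a % d) +ᶻ + (a / d) *ᶻ + d ∎

residue-unique⁺ : ∀ c {a b} k → a < c → b < c → + a -ᶻ + b ≡ + c *ᶻ + k → a ≡ b
residue-unique⁺ (suc c) {a} {b} k a<c b<c a-b≡ck = begin
  a                       ≡⟨ sym (ND.m<n⇒m%n≡m a<c) ⟩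
  a % suc c               ≡⟨ cong (_% suc c) a≡b+kc ⟩
  (b + k * suc c) % suc c ≡⟨ ND.[m+kn]%n≡m%n b k (suc c) ⟩
  b % suc c               ≡⟨ ND.m<n⇒m%n≡m b<c ⟩
  b ∎
  where
  restore : ∀ a b → a ≡ b +ᶻ (a -ᶻ b)
  restore = solve-∀
  a≡b+kc : a ≡ b + k * suc c
  a≡b+kc = ZP.+-injective (begin
    + a                       ≡⟨ restore (+ a) (+ b) ⟩
    + b +ᶻ (+ a -ᶻ + b)       ≡⟨ cong (+ b +ᶻ_) a-b≡ck ⟩
    + b +ᶻ + suc c *ᶻ + k     ≡⟨ cong (+ b +ᶻ_) (ZP.*-comm (+ suc c) (+ k)) ⟩
    + b +ᶻ + k *ᶻ + suc c     ≡⟨ sym (pos-digits k b (suc c)) ⟩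
    + (b + k * suc c) ∎)

residue-unique : ∀ c {a b} → a < c → b < c → (z : ℤ) → + a -ᶻ + b ≡ + c *ᶻ z → a ≡ b
residue-unique c a<c b<c (+ k) a-b≡ck = residue-unique⁺ c k a<c b<c a-b≡ck
residue-unique c {a} {b} a<c b<c -[1+ k ] a-b≡ck = sym (residue-unique⁺ c (suc k) b<c a<c (begin
  + b -ᶻ + a             ≡⟨ flip (+ a) (+ b) ⟩
  -ᶻ (+ a -ᶻ + b)        ≡⟨ cong -ᶻ_ a-b≡ck ⟩
  -ᶻ (+ c *ᶻ -[1+ k ])   ≡⟨ ZP.neg-distribʳ-* (+ c) -[1+ k ] ⟩
  + c *ᶻ + suc k ∎))
  where
  flip : ∀ a b → b -ᶻ a ≡ -ᶻ (a -ᶻ b)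
  flip = solve-∀

constModulo-agree : ∀ {n c} {w w' : Fin n → ℕ} → (∀ j → w j < c) → (∀ j → w' j < c) →
  ConstModulo c (⟦ w ⟧ ⊖ ⟦ w' ⟧) → ∀ i₀ → w i₀ ≡ w' i₀ → ∀ j → w j ≡ w' j
constModulo-agree {c = c} {w} {w'} w<c w'<c w-w'≡t i₀ wᵢ₀≡w'ᵢ₀ j
  with z , difference ← constModulo-diff {c = c} w-w'≡t j i₀ =
  residue-unique c (w<c j) (w'<c j) z (begin
    + w j -ᶻ + w' j                                  ≡⟨ sym (ZP.+-identityʳ _) ⟩
    (+ w j -ᶻ + w' j) -ᶻ + 0                         ≡⟨ cong (λ y → (+ w j -ᶻ + w' j) -ᶻ y) (sym vanish) ⟩
    (+ w j -ᶻ + w' j) -ᶻ (+ w i₀ -ᶻ + w' i₀)         ≡⟨ difference ⟩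
    + c *ᶻ z ∎)
  where
  vanish : + w i₀ -ᶻ + w' i₀ ≡ + 0
  vanish = trans (cong (λ y → + y -ᶻ + w' i₀) wᵢ₀≡w'ᵢ₀) (ZP.+-inverseʳ (+ w' i₀))

constModulo-injective : ∀ {n c} {b : Fin n → ℕ} → n ≤ c →
  ConstModulo c (⟦ toℕ ⟧ ⊖ ⟦ b ⟧) → ∀ i j → b i ≡ b j → i ≡ j
constModulo-injective {c = c} {b} n≤c j-b≡t i j bᵢ≡bⱼ
  with z , difference ← constModulo-diff {c = c} j-b≡t i j =
  FP.toℕ-injective (residue-unique c (below i) (below j) z (begin
    + toℕ i -ᶻ + toℕ j                               ≡⟨ insert (+ toℕ i) (+ toℕ j) (+ b j) ⟩
    (+ toℕ i -ᶻ + b j) -ᶻ (+ toℕ j -ᶻ + b j)         ≡⟨ cong (λ y → (+ toℕ i -ᶻ + y) -ᶻ (+ toℕ j -ᶻ + b j)) (sym bᵢ≡bⱼ) ⟩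
    (+ toℕ i -ᶻ + b i) -ᶻ (+ toℕ j -ᶻ + b j)         ≡⟨ difference ⟩
    + c *ᶻ z ∎))
  where
  below : ∀ i → toℕ i < c
  below i = NP.<-≤-trans (FP.toℕ<n i) n≤c
  insert : ∀ a a' x → a -ᶻ a' ≡ (a -ᶻ x) -ᶻ (a' -ᶻ x)
  insert = solve-∀

module Digits (n m' : ℕ) where

  m : ℕ
  m = suc m'

  open Lattice n m public

  reduce : ∀ (x : Vecℤ n) (w : Fin n → ℕ) (τ : ℤ) (k : Vecℤ n) →
    (∀ j → x j ZD./ℕ m +ᶻ τ ≡ + w j +ᶻ + suc n *ᶻ k j) →
    x ≅ (λ j → + (x j ZD.%ℕ m + m * w j))
  reduce x w τ k w≡ = ≅-by (-ᶻ τ , k , λ j → begin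
    x j -ᶻ + (s j + m * w j)
      ≡⟨ cong₂ _-ᶻ_ (ZD.a≡a%ℕn+[a/ℕn]*n (x j) m) (pos-digits m (s j) (w j)) ⟩
    (+ s j +ᶻ y j *ᶻ + m) -ᶻ (+ s j +ᶻ + m *ᶻ + w j)
      ≡⟨ factor (+ s j) (y j) (+ m) (+ w j) τ ⟩
    + m *ᶻ ((y j +ᶻ τ) -ᶻ + w j -ᶻ τ)
      ≡⟨ cong (λ z → + m *ᶻ (z -ᶻ + w j -ᶻ τ)) (w≡ j) ⟩
    + m *ᶻ ((+ w j +ᶻ + suc n *ᶻ k j) -ᶻ + w j -ᶻ τ)
      ≡⟨ cancel (+ m) (+ w j) (+ suc n *ᶻ k j) τ ⟩
    + m *ᶻ (-ᶻ τ +ᶻ + suc n *ᶻ k j) ∎)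
    where
    s : Fin n → ℕ
    s j = x j ZD.%ℕ m
    y : Vecℤ n
    y j = x j ZD./ℕ m
    factor : ∀ s y m w τ → (s +ᶻ y *ᶻ m) -ᶻ (s +ᶻ m *ᶻ w) ≡ m *ᶻ ((y +ᶻ τ) -ᶻ w -ᶻ τ)
    factor = solve-∀
    cancel : ∀ m w K τ → m *ᶻ ((w +ᶻ K) -ᶻ w -ᶻ τ) ≡ m *ᶻ (-ᶻ τ +ᶻ K)
    cancel = solve-∀

  unique : ∀ {s s' w w' : Fin n → ℕ} → (∀ j → s j < m) → (∀ j → s' j < m) →
    (λ j → + (s j + m * w j)) ≅ (λ j → + (s' j + m * w' j)) →
    (∀ j → s j ≡ s' j) × ConstModulo (suc n) (⟦ w ⟧ ⊖ ⟦ w' ⟧)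
  unique {s} {s'} {w} {w'} s<m s'<m (≅-by (t , d , digits≡)) = low , t , d , high
    where
    X : Vecℤ n
    X j = t +ᶻ + suc n *ᶻ d j
    digits≡' : ∀ j → (+ s j +ᶻ + m *ᶻ + w j) -ᶻ (+ s' j +ᶻ + m *ᶻ + w' j) ≡ + m *ᶻ X j
    digits≡' j = trans (sym (cong₂ _-ᶻ_ (pos-digits m (s j) (w j)) (pos-digits m (s' j) (w' j)))) (digits≡ j)
    split : ∀ s s' w w' m → s -ᶻ s' ≡ ((s +ᶻ m *ᶻ w) -ᶻ (s' +ᶻ m *ᶻ w')) -ᶻ m *ᶻ (w -ᶻ w')
    split = solve-∀
    factor : ∀ m X W → m *ᶻ X -ᶻ m *ᶻ W ≡ m *ᶻ (X -ᶻ W)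
    factor = solve-∀
    low : ∀ j → s j ≡ s' j
    low j = residue-unique m (s<m j) (s'<m j) (X j -ᶻ (+ w j -ᶻ + w' j)) (begin
      + s j -ᶻ + s' j
        ≡⟨ split (+ s j) (+ s' j) (+ w j) (+ w' j) (+ m) ⟩
      ((+ s j +ᶻ + m *ᶻ + w j) -ᶻ (+ s' j +ᶻ + m *ᶻ + w' j)) -ᶻ + m *ᶻ (+ w j -ᶻ + w' j)
        ≡⟨ cong (λ z → z -ᶻ + m *ᶻ (+ w j -ᶻ + w' j)) (digits≡' j) ⟩
      + m *ᶻ X j -ᶻ + m *ᶻ (+ w j -ᶻ + w' j)
        ≡⟨ factor (+ m) (X j) (+ w j -ᶻ + w' j) ⟩
      + m *ᶻ (X j -ᶻ (+ w j -ᶻ + w' j)) ∎)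
    expand : ∀ s m w w' → m *ᶻ (w -ᶻ w') ≡ (s +ᶻ m *ᶻ w) -ᶻ (s +ᶻ m *ᶻ w')
    expand = solve-∀
    high : ∀ j → + w j -ᶻ + w' j ≡ t +ᶻ + suc n *ᶻ d j
    high j = ZP.*-cancelˡ-≡ (+ m) _ _ (begin
      + m *ᶻ (+ w j -ᶻ + w' j)
        ≡⟨ expand (+ s j) (+ m) (+ w j) (+ w' j) ⟩
      (+ s j +ᶻ + m *ᶻ + w j) -ᶻ (+ s j +ᶻ + m *ᶻ + w' j)
        ≡⟨ cong (λ a → (+ s j +ᶻ + m *ᶻ + w j) -ᶻ (+ a +ᶻ + m *ᶻ + w' j)) (low j) ⟩
      (+ s j +ᶻ + m *ᶻ + w j) -ᶻ (+ s' j +ᶻ + m *ᶻ + w' j)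
        ≡⟨ digits≡' j ⟩
      + m *ᶻ X j ∎)

atLeast : ℕ → ℕ → ℕ
atLeast c x = if does (c ≤? x) then 1 else 0

atLeast-yes : ∀ {c x} → c ≤ x → atLeast c x ≡ 1
atLeast-yes {c} {x} c≤x rewrite dec-true (c ≤? x) c≤x = refl

atLeast-no : ∀ {c x} → x < c → atLeast c x ≡ 0
atLeast-no {c} {x} x<c rewrite dec-false (c ≤? x) (NP.<⇒≱ x<c) = refl

atLeast-suc : ∀ c x → atLeast (suc c) (suc x) ≡ atLeast c x
atLeast-suc c x with c ≤? x
... | yes c≤x = trans (atLeast-yes (s≤s c≤x)) (sym (atLeast-yes c≤x))
... | no  c≰x = trans (atLeast-no (s≤s (NP.≰⇒> c≰x))) (sym (atLeast-no (NP.≰⇒> c≰x)))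

rangeSum : ℕ → (ℕ → ℕ) → ℕ
rangeSum zero    f = 0
rangeSum (suc k) f = f k + rangeSum k f

C2-suc : ∀ k → suc k C 2 ≡ k + k C 2
C2-suc k = trans (sym (NC.nCk+nC[k+1]≡[n+1]C[k+1] k 1)) (cong (_+ k C 2) (NC.nC1≡n k))

rangeSum-id : ∀ k → rangeSum k (λ j → j) ≡ k C 2
rangeSum-id zero    = refl
rangeSum-id (suc k) = trans (cong (λ t → k + t) (rangeSum-id k)) (sym (C2-suc k))

rangeSum-mono : ∀ k {f g : ℕ → ℕ} → (∀ j → j < k → f j ≤ g j) → rangeSum k f ≤ rangeSum k g
rangeSum-mono zero    f≤g = z≤n
rangeSum-mono (suc k) f≤g = NP.+-mono-≤ (f≤g k (NP.n<1+n k)) (rangeSum-mono k (λ j j<k → f≤g j (NP.m<n⇒m<1+n j<k)))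

sum-rangeSum : ∀ {n} k (F : Fin n → ℕ → ℕ) → sum (λ i → rangeSum k (F i)) ≡ rangeSum k (λ j → sum (λ i → F i j))
sum-rangeSum {n} zero    F = sum-replicate-zero n
sum-rangeSum     (suc k) F =
  trans (∑-distrib-+ (λ i → F i k) (λ i → rangeSum k (F i))) (cong (λ t → sum (λ i → F i k) + t) (sum-rangeSum k F))

rangeSum-atLeast : ∀ k c w → rangeSum k (λ j → atLeast c (w + j)) ≡ k ∸ (c ∸ w)
rangeSum-atLeast zero    c w = sym (NP.0∸n≡0 (c ∸ w))
rangeSum-atLeast (suc k) c w with (c ∸ w) ≤? k
... | yes c∸w≤k = trans (cong₂ _+_ (atLeast-yes c≤w+k) (rangeSum-atLeast k c w)) (sym (NP.+-∸-assoc 1 c∸w≤k))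
  where
  c≤w+k : c ≤ w + k
  c≤w+k = NP.≤-trans (NP.m≤n+m∸n c w) (NP.+-monoʳ-≤ w c∸w≤k)
... | no  c∸w≰k = trans (cong₂ _+_ (atLeast-no w+k<c) (rangeSum-atLeast k c w))
                        (trans (NP.m≤n⇒m∸n≡0 (NP.<⇒≤ k<c∸w)) (sym (NP.m≤n⇒m∸n≡0 k<c∸w)))
  where
  k<c∸w : k < c ∸ w
  k<c∸w = NP.≰⇒> c∸w≰k
  w+k<c : w + k < c
  w+k<c = NP.≰⇒> (λ c≤w+k → c∸w≰k (NP.m≤n+o⇒m∸n≤o c w c≤w+k))

layer-cake : ∀ {n w} → w ≤ n → rangeSum n (λ j → atLeast n (w + j)) ≡ w
layer-cake {n} {w} w≤n = trans (rangeSum-atLeast n n w) (NP.m∸[m∸n]≡n w≤n)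

wrap : ∀ {n w s} → w ≤ n → s ≤ n → (w + s) % suc n + suc n * atLeast (suc n) (w + s) ≡ w + s
wrap {n} {w} {s} w≤n s≤n with suc n ≤? w + s
... | yes N≤w+s = begin
  (w + s) % suc n + suc n * atLeast (suc n) (w + s)
    ≡⟨ cong₂ _+_ reduced (trans (cong (suc n *_) (atLeast-yes N≤w+s)) (NP.*-identityʳ (suc n))) ⟩
  (w + s ∸ suc n) + suc n
    ≡⟨ NP.m∸n+n≡m N≤w+s ⟩
  w + s ∎
  where
  excess< : w + s ∸ suc n < suc n
  excess< = NP.m<n+o⇒m∸n<o (w + s) (suc n) (s≤s (NP.+-mono-≤ w≤n (NP.≤-trans s≤n (NP.n≤1+n n))))
  reduced : (w + s) % suc n ≡ w + s ∸ suc n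
  reduced = trans (sym (ND.m≤n⇒[n∸m]%m≡n%m N≤w+s)) (ND.m<n⇒m%n≡m excess<)
... | no N≰w+s = trans (cong₂ _+_ (ND.m<n⇒m%n≡m w+s<N) (trans (cong (suc n *_) (atLeast-no w+s<N)) (NP.*-zeroʳ (suc n))))
                       (NP.+-identityʳ (w + s))
  where
  w+s<N : w + s < suc n
  w+s<N = NP.≰⇒> N≰w+s

rotate-sum : ∀ {n} (w : Fin n → ℕ) → (∀ i → w i ≤ n) → ∀ {s} → s ≤ n →
  sum (λ i → (w i + s) % suc n) + suc n * sum (λ i → atLeast (suc n) (w i + s)) ≡ sum w + n * s
rotate-sum {n} w w≤n {s} s≤n = begin
  sum rotated + suc n * sum wraps          ≡⟨ cong (λ t → sum rotated + t) (*-distribˡ-sum (suc n) wraps) ⟩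
  sum rotated + sum (λ i → suc n * wraps i) ≡⟨ sym (∑-distrib-+ rotated (λ i → suc n * wraps i)) ⟩
  sum (λ i → rotated i + suc n * wraps i)  ≡⟨ sum-cong-≗ (λ i → wrap (w≤n i) s≤n) ⟩
  sum (λ i → w i + s)                       ≡⟨ ∑-distrib-+ w (λ _ → s) ⟩
  sum w + sum {n} (λ _ → s)                 ≡⟨ cong (λ t → sum w + t) (sum-const {n} s) ⟩
  sum w + n * s ∎
  where
  rotated wraps : Fin n → ℕ
  rotated i = (w i + s) % suc n
  wraps i = atLeast (suc n) (w i + s)

-- If no rotation decreases Σw (entries ≤ n, rotations mod n+1), then
-- Σw ≤ C(n,2): rotating by j+1 wraps at most j entries around, so at most
-- j entries reach level n - j, and the layer-cake sum is ≤ Σ_{j<n} j.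
minimal-rotation : ∀ {n} (w : Fin n → ℕ) → (∀ i → w i ≤ n) →
  (∀ s → s ≤ n → sum w ≤ sum (λ i → (w i + s) % suc n)) → sum w ≤ n C 2
minimal-rotation {n} w w≤n minimal =
  NP.≤-trans (NP.≤-reflexive layers) (NP.≤-trans (rangeSum-mono n wraps≤) (NP.≤-reflexive (rangeSum-id n)))
  where
  -- wraps j counts the entries wrapped around by the rotation by j + 1.
  wraps : ℕ → ℕ
  wraps j = sum (λ i → atLeast n (w i + j))
  layers : sum w ≡ rangeSum n wraps
  layers = trans (sum-cong-≗ (λ i → sym (layer-cake (w≤n i)))) (sum-rangeSum n (λ i j → atLeast n (w i + j)))
  wraps-shift : ∀ j → sum (λ i → atLeast (suc n) (w i + suc j)) ≡ wraps j
  wraps-shift j = sum-cong-≗ (λ i → trans (cong (atLeast (suc n)) (NP.+-suc (w i) j)) (atLeast-suc n (w i + j)))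
  wraps≤ : ∀ j → j < n → wraps j ≤ j
  wraps≤ j j<n = NP.≤-pred (NP.*-cancelˡ-< (suc n) (wraps j) (suc j) (NP.≤-<-trans few (NP.*-monoˡ-< (suc j) (NP.n<1+n n))))
    where
    balance : sum (λ i → (w i + suc j) % suc n) + suc n * wraps j ≡ sum w + n * suc j
    balance = trans (cong (λ c → sum (λ i → (w i + suc j) % suc n) + suc n * c) (sym (wraps-shift j))) (rotate-sum w w≤n j<n)
    few : suc n * wraps j ≤ n * suc j
    few = NP.+-cancelˡ-≤ (sum w) _ _
      (NP.≤-trans (NP.+-monoˡ-≤ (suc n * wraps j) (minimal (suc j) j<n)) (NP.≤-reflexive balance))

≤-suc-cases : ∀ {t k} → t ≤ suc k → t ≤ k ⊎ t ≡ suc k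
≤-suc-cases t≤1+k with NP.m≤n⇒m<n∨m≡n t≤1+k
... | inj₁ t<1+k = inj₁ (NP.≤-pred t<1+k)
... | inj₂ t≡1+k = inj₂ t≡1+k

argmin : ∀ k (g : ℕ → ℕ) → Σ ℕ λ t → t ≤ k × (∀ t' → t' ≤ k → g t ≤ g t')
argmin zero    g = 0 , z≤n , λ { _ z≤n → NP.≤-refl }
argmin (suc k) g with argmin k g
... | t , t≤k , least with g t ≤? g (suc k)
...   | yes gₜ≤ = t , NP.m≤n⇒m≤1+n t≤k , λ t' t'≤ →
  [ least t' , (λ { refl → gₜ≤ }) ] (≤-suc-cases t'≤)
...   | no  gₜ≰ = suc k , NP.≤-refl , λ t' t'≤ →
  [ (λ t'≤k → NP.≤-trans (NP.<⇒≤ (NP.≰⇒> gₜ≰)) (least t' t'≤k)) , (λ { refl → NP.≤-refl }) ] (≤-suc-cases t'≤)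

rotate-rotate : ∀ q t s d .{{_ : NonZero d}} → ((q + t) % d + s) % d ≡ (q + (t + s) % d) % d
rotate-rotate q t s d = begin
  ((q + t) % d + s) % d   ≡⟨ absorbˡ (q + t) s ⟩
  ((q + t) + s) % d       ≡⟨ cong (_% d) (NP.+-assoc q t s) ⟩
  (q + (t + s)) % d       ≡⟨ sym absorbʳ ⟩
  (q + (t + s) % d) % d ∎
  where
  absorbˡ : ∀ a b → (a % d + b) % d ≡ (a + b) % d
  absorbˡ a b = begin
    (a % d + b) % d           ≡⟨ ND.%-distribˡ-+ (a % d) b d ⟩
    (a % d % d + b % d) % d   ≡⟨ cong (λ x → (x + b % d) % d) (ND.m%n%n≡m%n a d) ⟩
    (a % d + b % d) % d       ≡⟨ sym (ND.%-distribˡ-+ a b d) ⟩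
    (a + b) % d ∎
  absorbʳ : (q + (t + s) % d) % d ≡ (q + (t + s)) % d
  absorbʳ = begin
    (q + (t + s) % d) % d     ≡⟨ cong (_% d) (NP.+-comm q ((t + s) % d)) ⟩
    ((t + s) % d + q) % d     ≡⟨ absorbˡ (t + s) q ⟩
    ((t + s) + q) % d         ≡⟨ cong (_% d) (NP.+-comm (t + s) q) ⟩
    (q + (t + s)) % d ∎

-- Any n numbers can be rotated modulo n+1 so that their residues sum to
-- at most C(n,2): take a rotation minimising the sum.
rotation-bound : ∀ n (q : Fin n → ℕ) → ∃[ t ] sum (λ i → (q i + t) % suc n) ≤ n C 2
rotation-bound n q with argmin n (λ t → sum (λ i → (q i + t) % suc n))
... | t , _ , least =
  t , minimal-rotation (λ i → (q i + t) % suc n) (λ i → NP.≤-pred (ND.m%n<n (q i + t) (suc n))) no-better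
  where
  no-better : ∀ s → s ≤ n → sum (λ i → (q i + t) % suc n) ≤ sum (λ i → ((q i + t) % suc n + s) % suc n)
  no-better s _ = NP.≤-trans (least ((t + s) % suc n) (NP.≤-pred (ND.m%n<n (t + s) (suc n))))
    (NP.≤-reflexive (sum-cong-≗ (λ i → sym (rotate-rotate (q i) t s (suc n)))))

distinct-sum : ∀ n (b : Fin n → ℕ) → (∀ i j → b i ≡ b j → i ≡ j) → n C 2 ≤ sum b
distinct-sum zero    b _ = z≤n
distinct-sum (suc n) b b-inj with FP.any? (λ j → n ≤? b j)
... | yes (i , n≤bᵢ) = subst₂ _≤_ (sym (C2-suc n)) (sym (sum-remove {i = i} b))
  (NP.+-mono-≤ n≤bᵢ (distinct-sum n (b ∘ punchIn i) (λ x y bx≡by → FP.punchIn-injective i x y (b-inj _ _ bx≡by))))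
... | no  none-large with FP.pigeonhole (NP.n<1+n n) (λ j → fromℕ< (small j))
  where
  small : ∀ j → b j < n
  small j = NP.≰⇒> (λ n≤bⱼ → none-large (j , n≤bⱼ))
...   | x , y , x<y , same = ⊥-elim (NP.<-irrefl (cong toℕ (b-inj x y bx≡by)) x<y)
  where
  bx≡by : b x ≡ b y
  bx≡by = trans (sym (FP.toℕ-fromℕ< _)) (trans (cong toℕ same) (FP.toℕ-fromℕ< _))

funToFin-cong : ∀ {k a} {f g : Fin k → Fin a} → (∀ i → f i ≡ g i) → funToFin f ≡ funToFin g
funToFin-cong {zero}  f≗g = refl
funToFin-cong {suc k} f≗g = cong₂ combine (f≗g zero) (funToFin-cong (f≗g ∘ suc))

module Encoding (a k b l : ℕ) where

  decode : Fin (a ^ k * b ^ l) → (Fin k → Fin a) × (Fin l → Fin b)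
  decode p = finToFun (proj₁ (remQuot {a ^ k} (b ^ l) p)) , finToFun (proj₂ (remQuot {a ^ k} (b ^ l) p))

  encode : (Fin k → Fin a) → (Fin l → Fin b) → Fin (a ^ k * b ^ l)
  encode f g = combine (funToFin f) (funToFin g)

  decode-encode : ∀ f g →
    (∀ i → proj₁ (decode (encode f g)) i ≡ f i) × (∀ j → proj₂ (decode (encode f g)) j ≡ g j)
  decode-encode f g =
    (λ i → trans (cong (λ r → finToFun (proj₁ r) i) split) (FP.finToFun-funToFin f i)) ,
    (λ j → trans (cong (λ r → finToFun (proj₂ r) j) split) (FP.finToFun-funToFin g j))
    where
    split : remQuot {a ^ k} (b ^ l) (encode f g) ≡ (funToFin f , funToFin g)
    split = FP.remQuot-combine (funToFin f) (funToFin g)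

  decode-injective : ∀ p p' →
    (∀ i → proj₁ (decode p) i ≡ proj₁ (decode p') i) → (∀ j → proj₂ (decode p) j ≡ proj₂ (decode p') j) → p ≡ p'
  decode-injective p p' same₁ same₂ =
    trans (encode-decode p) (trans (cong₂ combine (funToFin-cong same₁) (funToFin-cong same₂)) (sym (encode-decode p')))
    where
    encode-decode : ∀ p → p ≡ encode (proj₁ (decode p)) (proj₂ (decode p))
    encode-decode p = sym (trans
      (cong₂ combine (FP.funToFin-finToFin {k} {a} _) (FP.funToFin-finToFin {l} {b} _))
      (FP.combine-remQuot {a ^ k} (b ^ l) p))

-- The order of ℤⁿ / M ℤⁿ (n ≥ 1, m ≥ 1) is m^n (n+1)^(n-1): each class
-- contains exactly one digit vector (s_j + m·w_j) with w at the first
-- coordinate equal to 0.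
module Order (n' m' : ℕ) where

  n : ℕ
  n = suc n'

  open Digits n m'
  open Encoding m n (suc n) n'

  high : (Fin n' → Fin (suc n)) → Fin n → ℕ
  high q zero    = 0
  high q (suc i) = toℕ (q i)

  high< : ∀ q j → high q j < suc n
  high< q zero    = s≤s z≤n
  high< q (suc i) = FP.toℕ<n (q i)

  representative : Fin (m ^ n * suc n ^ n') → Vecℤ n
  representative p j = + (toℕ (proj₁ (decode p) j) + m * high (proj₂ (decode p)) j)

  -- Reduce u with the shift τ = -⌊u_1/m⌋, which makes the first high digit 0.
  surjective : ∀ u → ∃[ p ] (u ≈[ M ] representative p)
  surjective u = encode low q , ≅⇒≈ (≅-resp (λ _ → refl) digits≡ (reduce u w (-ᶻ y zero) k congruent))
    where
    y z : Vecℤ n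
    y j = u j ZD./ℕ m
    z j = y j -ᶻ y zero
    w : Fin n → ℕ
    w zero    = 0
    w (suc i) = z (suc i) ZD.%ℕ suc n
    k : Vecℤ n
    k zero    = + 0
    k (suc i) = z (suc i) ZD./ℕ suc n
    vanish : ∀ c → + 0 ≡ + 0 +ᶻ c *ᶻ + 0
    vanish = solve-∀
    congruent : ∀ j → y j +ᶻ -ᶻ y zero ≡ + w j +ᶻ + suc n *ᶻ k j
    congruent zero    = trans (ZP.+-inverseʳ (y zero)) (vanish (+ suc n))
    congruent (suc i) = trans (ZD.a≡a%ℕn+[a/ℕn]*n (z (suc i)) (suc n)) (cong (+ w (suc i) +ᶻ_) (ZP.*-comm (k (suc i)) (+ suc n)))
    low : Fin n → Fin m
    low j = fromℕ< (ZD.n%ℕd<d (u j) m)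
    q : Fin n' → Fin (suc n)
    q i = fromℕ< (ZD.n%ℕd<d (z (suc i)) (suc n))
    high≡ : ∀ j → high (proj₂ (decode (encode low q))) j ≡ w j
    high≡ zero    = refl
    high≡ (suc i) = trans (cong toℕ (proj₂ (decode-encode low q) i)) (FP.toℕ-fromℕ< _)
    digits≡ : ∀ j → representative (encode low q) j ≡ + (u j ZD.%ℕ m + m * w j)
    digits≡ j = cong₂ (λ s h → + (s + m * h))
      (trans (cong toℕ (proj₁ (decode-encode low q) j)) (FP.toℕ-fromℕ< _)) (high≡ j)

  -- Congruent representatives have equal low digits, and high digits that
  -- agree mod n+1 up to a constant, which is 0 since both vanish at 0.
  injective : ∀ p p' → representative p ≈[ M ] representative p' → p ≡ p'
  injective p p' rep≈rep'
    with low≡ , high-const ← unique (λ j → FP.toℕ<n (proj₁ (decode p) j)) (λ j → FP.toℕ<n (proj₁ (decode p') j))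
                                    (≈⇒≅ rep≈rep') =
    decode-injective p p' (λ j → FP.toℕ-injective (low≡ j)) (λ i → FP.toℕ-injective (high≡ (suc i)))
    where
    high≡ : ∀ j → high (proj₂ (decode p)) j ≡ high (proj₂ (decode p')) j
    high≡ = constModulo-agree (high< _) (high< _) high-const zero refl

  order : QuotientOrder M (m ^ n * suc n ^ n')
  order = representative , surjective , injective

diameter-value : ∀ n m' → (suc n C 2) * suc m' ∸ n ≡ n * m' + suc m' * (n C 2)
diameter-value n m' = begin
  (suc n C 2) * suc m' ∸ n              ≡⟨ cong (λ c → c * suc m' ∸ n) (C2-suc n) ⟩
  (n + n C 2) * suc m' ∸ n            ≡⟨ cong (_∸ n) (expand n m' (n C 2)) ⟩
  n + (n * m' + suc m' * (n C 2)) ∸ n   ≡⟨ NP.m+n∸m≡n n _ ⟩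
  n * m' + suc m' * (n C 2) ∎
  where
  expand : ∀ n m' c → (n + c) * suc m' ≡ n + (n * m' + suc m' * c)
  expand = NS.solve-∀

module DiameterBounds (n m' : ℕ) where

  open Digits n m'

  D : ℕ
  D = n * m' + m * (n C 2)

  -- Reduce v - u to digits (s, w) with the high digits rotated to have
  -- Σw ≤ C(n,2); the step counts s_j + m·w_j then total at most D.
  upper : ∀ u v → ∃[ k ] (k ≤ D × Walk M k u v)
  upper u v = sum a , short , walkWithCounts a {u} {v} (reduce x w (+ t) k congruent)
    where
    x y : Vecℤ n
    x = v ⊖ u
    y j = x j ZD./ℕ m
    q : Fin n → ℕ
    q j = y j ZD.%ℕ suc n
    t : ℕ
    t = proj₁ (rotation-bound n q)
    s w a : Fin n → ℕ
    s j = x j ZD.%ℕ m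
    w j = (q j + t) % suc n
    a j = s j + m * w j
    K : Vecℤ n
    K j = y j ZD./ℕ suc n
    h : Fin n → ℕ
    h j = (q j + t) / suc n
    k : Vecℤ n
    k j = K j +ᶻ + h j
    swap : ∀ q K t → (q +ᶻ K) +ᶻ t ≡ (q +ᶻ t) +ᶻ K
    swap = solve-∀
    collect : ∀ w h K N → (w +ᶻ h *ᶻ N) +ᶻ K *ᶻ N ≡ w +ᶻ N *ᶻ (K +ᶻ h)
    collect = solve-∀
    congruent : ∀ j → y j +ᶻ + t ≡ + w j +ᶻ + suc n *ᶻ k j
    congruent j = begin
      y j +ᶻ + t
        ≡⟨ cong (_+ᶻ + t) (ZD.a≡a%ℕn+[a/ℕn]*n (y j) (suc n)) ⟩
      (+ q j +ᶻ K j *ᶻ + suc n) +ᶻ + t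
        ≡⟨ swap (+ q j) (K j *ᶻ + suc n) (+ t) ⟩
      (+ q j +ᶻ + t) +ᶻ K j *ᶻ + suc n
        ≡⟨ cong (_+ᶻ K j *ᶻ + suc n) (trans (sym (ZP.pos-+ (q j) t)) (pos-divMod (q j + t) (suc n))) ⟩
      (+ w j +ᶻ + h j *ᶻ + suc n) +ᶻ K j *ᶻ + suc n
        ≡⟨ collect (+ w j) (+ h j) (K j) (+ suc n) ⟩
      + w j +ᶻ + suc n *ᶻ k j ∎
    short : sum a ≤ D
    short = NP.≤-trans (NP.≤-reflexive split) (NP.+-mono-≤ lows highs)
      where
      split : sum a ≡ sum s + m * sum w
      split = trans (∑-distrib-+ s (λ j → m * w j)) (cong (λ c → sum s + c) (sym (*-distribˡ-sum m w)))
      lows : sum s ≤ n * m'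
      lows = NP.≤-trans (sum-mono (λ j → NP.≤-pred (ZD.n%ℕd<d (x j) m))) (NP.≤-reflexive (sum-const {n} m'))
      highs : m * sum w ≤ m * (n C 2)
      highs = NP.*-monoʳ-≤ m (proj₂ (rotation-bound n q))

  origin far : Vecℤ n
  origin _ = + 0
  far j = + (m' + m * toℕ j)

  -- Step counts a leading from origin to far are a_j = (m-1) + m·b_j with
  -- j ↦ j - b_j constant mod n+1, so the b_j are distinct and Σb ≥ C(n,2).
  counts-lower : ∀ (a : Fin n → ℕ) → (far ⊖ origin) ≅ ⟦ a ⟧ → D ≤ sum a
  counts-lower a far≅a = NP.≤-trans (NP.+-monoʳ-≤ (n * m') (NP.*-monoʳ-≤ m spread)) (NP.≤-reflexive (sym Σa))
    where
    b : Fin n → ℕ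
    b j = a j / m
    a-digits : ∀ j → a j ≡ a j % m + m * b j
    a-digits j = trans (ND.m≡m%n+[m/n]*n (a j) m) (cong (λ c → a j % m + c) (NP.*-comm (b j) m))
    far≅digits : far ≅ (λ j → + (a j % m + m * b j))
    far≅digits = ≅-resp (λ j → sym (ZP.+-identityʳ (far j))) (λ j → cong +_ (sym (a-digits j))) far≅a
    digits = unique {s = λ _ → m'} {w = toℕ} (λ _ → NP.n<1+n m') (λ j → ND.m%n<n (a j) m) far≅digits
    spread : n C 2 ≤ sum b
    spread = distinct-sum n b (constModulo-injective (NP.n≤1+n n) (proj₂ digits))
    Σa : sum a ≡ n * m' + m * sum b
    Σa = begin
      sum a                                   ≡⟨ sum-cong-≗ (λ j → trans (a-digits j) (cong (_+ m * b j) (sym (proj₁ digits j)))) ⟩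
      sum (λ j → m' + m * b j)                ≡⟨ ∑-distrib-+ (λ _ → m') (λ j → m * b j) ⟩
      sum {n} (λ _ → m') + sum (λ j → m * b j) ≡⟨ cong₂ _+_ (sum-const {n} m') (sym (*-distribˡ-sum m b)) ⟩
      n * m' + m * sum b ∎

  lower : ∀ k → Walk M k origin far → D ≤ k
  lower k W with a , Σa≡k , far≅a ← stepCounts W = subst (D ≤_) Σa≡k (counts-lower a far≅a)

  diameter : Diameter M D
  diameter = upper , origin , far , lower

mainTheorem3 : (n m : ℕ) → 2 ≤ n → 1 ≤ m →
    QuotientOrder (Mcirc n m) (m ^ n * (suc n) ^ (n ∸ 1)) ×
    Diameter (Mcirc n m) (((suc n) C 2) * m ∸ n)
mainTheorem3 zero     m        ()  _
mainTheorem3 (suc n') zero     _   ()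
mainTheorem3 (suc n') (suc m') _   _  =
  Order.order n' m' ,
  subst (Diameter (Mcirc (suc n') (suc m'))) (sym (diameter-value (suc n') m')) (DiameterBounds.diameter (suc n') m')
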